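{- There are infinitely many quartic Diophantine triples $\{a,b,c\}$ with $a>0$, $b>0$ and $c>0$.
   Context: A quartic Diophantine triple is a set $\{a,b,c\}$ of three distinct nonzero rational numbers such that $ab+1=r^4$, $ac+1=s^4$, $bc+1=t^4$ for some rational numbers $r,s,t$. -}

module Defs where

open import Data.Rational using (ℚ; _*_; _+_; _<_; 0ℚ; 1ℚ)
open import Data.Product using (Σ; ∃; _×_; _,_)
open import Data.List using (List)
open import Data.List.Relation.Unary.All using (All)
open import Relation.Binary.PropositionalEquality using (_≡_)
open import Relation.Nullary using (¬_)
open import Data.Sum using (_⊎_)

_⁴ : ℚ → ℚ
x ⁴ = x * x * x * x

IsQuarticDiophantineTriple : ℚ → ℚ → ℚ → Set
IsQuarticDiophantineTriple a b c =
  ¬ (a ≡ b) × ¬ (a ≡ c) × ¬ (b ≡ c) ×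
  ¬ (a ≡ 0ℚ) × ¬ (b ≡ 0ℚ) × ¬ (c ≡ 0ℚ) ×
  (∃ λ r → a * b + 1ℚ ≡ r ⁴) ×
  (∃ λ s → a * c + 1ℚ ≡ s ⁴) ×
  (∃ λ t → b * c + 1ℚ ≡ t ⁴)

-- An (ordered) triple of rationals, representing the set {a,b,c}
Triple : Set
Triple = ℚ × ℚ × ℚ

_∈₃_ : ℚ → Triple → Set
x ∈₃ (a , b , c) = (x ≡ a) ⊎ (x ≡ b) ⊎ (x ≡ c)

SameSet : Triple → Triple → Set
SameSet (a , b , c) T' = a ∈₃ T' × b ∈₃ T' × c ∈₃ T'

SameSet₃ : Triple → Triple → Set
SameSet₃ T T' = SameSet T T' × SameSet T' T

PositiveQDT : Triple → Set
PositiveQDT (a , b , c) =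
  IsQuarticDiophantineTriple a b c × (0ℚ < a) × (0ℚ < b) × (0ℚ < c)

-- "infinitely many" (as sets): no finite list of sets exhausts them
InfinitelyManyPositiveQDT : Set
InfinitelyManyPositiveQDT =
  (L : List Triple) →
  Σ Triple λ T → PositiveQDT T × All (λ T' → ¬ SameSet₃ T T') L

-- Take a, b, c, r, s, t to be explicit rational functions of x with natural coefficients
-- (the simplest is t = (x + 10)/(x + 8)).  Cleared of denominators, ab + 1 = r⁴, ac + 1 = s⁴ and
-- bc + 1 = t⁴ are polynomial identities, and c < b < a and x < a hold for x ≥ 0 because
-- the cross-multiplied differences have natural coefficients and a positive constant
-- term; all of this is checked by computing coefficient lists.  Specialising at a
-- rational x ≥ 0 therefore gives a positive quartic triple, and since a > x, taking x
-- above every coordinate of finitely many given triples yields a triple outside them.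

module Submission where

open import Algebra.Bundles using (CommutativeSemiring)
open import Data.List using (List; []; _∷_)
open import Data.Nat as ℕ using (ℕ; zero; suc; _∸_)
open import Relation.Binary.PropositionalEquality using (_≡_)

-- Coefficient lists, constant term first.
Poly : Set
Poly = List ℕ

infixl 6 _⊕_
infixl 7 _⊗_
infixr 7 _·_
infix 4 _≺_

_⊕_ : Poly → Poly → Poly
[] ⊕ q = q
(m ∷ p) ⊕ [] = m ∷ p
(m ∷ p) ⊕ (n ∷ q) = (m ℕ.+ n) ∷ (p ⊕ q)

_·_ : ℕ → Poly → Poly
n · [] = []
n · (m ∷ p) = n ℕ.* m ∷ n · p

_⊗_ : Poly → Poly → Poly
[] ⊗ q = []
(m ∷ p) ⊗ q = m · q ⊕ (0 ∷ p ⊗ q)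

_⁴ₚ : Poly → Poly
p ⁴ₚ = p ⊗ p ⊗ p ⊗ p

X : Poly
X = 0 ∷ 1 ∷ []

data PositiveConstant : Poly → Set where
  instance suc∷ : ∀ {n p} → PositiveConstant (suc n ∷ p)

-- Truncated coefficientwise; _≺_ checks that nothing was truncated.
_⊖_ : Poly → Poly → Poly
p ⊖ [] = p
[] ⊖ (_ ∷ _) = []
(m ∷ p) ⊖ (n ∷ q) = (m ∸ n) ∷ (p ⊖ q)

data _≺_ (p q : Poly) : Set where
  ≺-gap : .{{_ : PositiveConstant (q ⊖ p)}} → p ⊕ (q ⊖ p) ≡ q → p ≺ q

module HornerEvaluation {c ℓ} (S : CommutativeSemiring c ℓ) where

  open CommutativeSemiring S
  open import Algebra.Properties.Semiring.Mult semiring using (_×_; ×-homo-+; ×1-homo-*)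
  open import Algebra.Properties.CommutativeSemigroup +-commutativeSemigroup using (interchange)
  open import Algebra.Properties.CommutativeSemigroup *-commutativeSemigroup using (x∙yz≈y∙xz)
  open import Relation.Binary.Reasoning.Setoid setoid

  ⟦_⟧ : Poly → Carrier → Carrier
  ⟦ [] ⟧ x = 0#
  ⟦ n ∷ p ⟧ x = n × 1# + x * ⟦ p ⟧ x

  ⟦⊕⟧ : ∀ p q x → ⟦ p ⊕ q ⟧ x ≈ ⟦ p ⟧ x + ⟦ q ⟧ x
  ⟦⊕⟧ [] q x = sym (+-identityˡ _)
  ⟦⊕⟧ (m ∷ p) [] x = sym (+-identityʳ _)
  ⟦⊕⟧ (m ∷ p) (n ∷ q) x = begin
    (m ℕ.+ n) × 1# + x * ⟦ p ⊕ q ⟧ x                  ≈⟨ +-cong (×-homo-+ 1# m n) (*-congˡ (⟦⊕⟧ p q x)) ⟩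
    (m × 1# + n × 1#) + x * (⟦ p ⟧ x + ⟦ q ⟧ x)       ≈⟨ +-congˡ (distribˡ x _ _) ⟩
    (m × 1# + n × 1#) + (x * ⟦ p ⟧ x + x * ⟦ q ⟧ x)   ≈⟨ interchange _ _ _ _ ⟩
    ⟦ m ∷ p ⟧ x + ⟦ n ∷ q ⟧ x                          ∎

  ⟦·⟧ : ∀ n p x → ⟦ n · p ⟧ x ≈ n × 1# * ⟦ p ⟧ x
  ⟦·⟧ n [] x = sym (zeroʳ _)
  ⟦·⟧ n (m ∷ p) x = begin
    (n ℕ.* m) × 1# + x * ⟦ n · p ⟧ x               ≈⟨ +-cong (×1-homo-* n m) (*-congˡ (⟦·⟧ n p x)) ⟩
    n × 1# * m × 1# + x * (n × 1# * ⟦ p ⟧ x)       ≈⟨ +-congˡ (x∙yz≈y∙xz x _ _) ⟩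
    n × 1# * m × 1# + n × 1# * (x * ⟦ p ⟧ x)       ≈⟨ distribˡ _ _ _ ⟨
    n × 1# * ⟦ m ∷ p ⟧ x                           ∎

  ⟦⊗⟧ : ∀ p q x → ⟦ p ⊗ q ⟧ x ≈ ⟦ p ⟧ x * ⟦ q ⟧ x
  ⟦⊗⟧ [] q x = sym (zeroˡ _)
  ⟦⊗⟧ (m ∷ p) q x = begin
    ⟦ m · q ⊕ (0 ∷ p ⊗ q) ⟧ x                 ≈⟨ ⟦⊕⟧ (m · q) (0 ∷ p ⊗ q) x ⟩
    ⟦ m · q ⟧ x + (0# + x * ⟦ p ⊗ q ⟧ x)      ≈⟨ +-cong (⟦·⟧ m q x) (+-identityˡ _) ⟩
    m × 1# * ⟦ q ⟧ x + x * ⟦ p ⊗ q ⟧ x        ≈⟨ +-congˡ (*-congˡ (⟦⊗⟧ p q x)) ⟩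
    m × 1# * ⟦ q ⟧ x + x * (⟦ p ⟧ x * ⟦ q ⟧ x) ≈⟨ +-congˡ (*-assoc x _ _) ⟨
    m × 1# * ⟦ q ⟧ x + x * ⟦ p ⟧ x * ⟦ q ⟧ x   ≈⟨ distribʳ _ _ _ ⟨
    ⟦ m ∷ p ⟧ x * ⟦ q ⟧ x                     ∎

  ⟦⁴ₚ⟧ : ∀ p x → ⟦ p ⁴ₚ ⟧ x ≈ ⟦ p ⟧ x * ⟦ p ⟧ x * ⟦ p ⟧ x * ⟦ p ⟧ x
  ⟦⁴ₚ⟧ p x = begin
    ⟦ p ⊗ p ⊗ p ⊗ p ⟧ x                         ≈⟨ ⟦⊗⟧ (p ⊗ p ⊗ p) p x ⟩
    ⟦ p ⊗ p ⊗ p ⟧ x * ⟦ p ⟧ x                   ≈⟨ *-congʳ (⟦⊗⟧ (p ⊗ p) p x) ⟩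
    ⟦ p ⊗ p ⟧ x * ⟦ p ⟧ x * ⟦ p ⟧ x             ≈⟨ *-congʳ (*-congʳ (⟦⊗⟧ p p x)) ⟩
    ⟦ p ⟧ x * ⟦ p ⟧ x * ⟦ p ⟧ x * ⟦ p ⟧ x       ∎

  ⟦X⟧ : ∀ x → ⟦ X ⟧ x ≈ x
  ⟦X⟧ x = begin
    0# + x * (1# + 0# + x * 0#)   ≈⟨ +-identityˡ _ ⟩
    x * (1# + 0# + x * 0#)        ≈⟨ *-congˡ (+-cong (+-identityʳ 1#) (zeroʳ x)) ⟩
    x * (1# + 0#)                 ≈⟨ *-congˡ (+-identityʳ 1#) ⟩
    x * 1#                        ≈⟨ *-identityʳ x ⟩
    x                             ∎

-- Imported only now: their _+_, _*_ and sym would clash with the semiring's above.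
open import Algebra.Bundles using (CommutativeRing)
open import Data.List.Relation.Unary.All using (All; []; _∷_)
open import Data.Product using (_,_; ∃)
open import Data.Rational
  using (ℚ; 0ℚ; 1ℚ; _+_; _*_; _÷_; 1/_; _<_; _≤_; _⊔_; NonZero; Positive; NonNegative; nonNegative)
open import Data.Rational.Properties
  using ( +-*-commutativeRing; +-identityʳ; *-assoc; *-comm; *-identityʳ; *-inverseˡ; *-inverseʳ
        ; ≤-trans; <-trans; <-irrefl; <⇒≢; ≤-<-trans; p≤p⊔q; p≤q⊔p; +-monoʳ-<; *-cancelʳ-<-nonNeg
        ; positive⁻¹; pos⇒nonZero; pos⇒nonNeg; 1/pos⇒pos; pos*pos⇒pos; pos+nonNeg⇒pos
        ; nonNeg+nonNeg⇒nonNeg; nonNeg*nonNeg⇒nonNeg; module ≤-Reasoning)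
open import Data.Rational.Solver using (module +-*-Solver)
open import Data.Sum using (inj₁; inj₂)
open import Function using (_∘_)
open import Relation.Binary.PropositionalEquality using (_≢_; refl; sym; trans; cong; cong₂; module ≡-Reasoning)
open import Relation.Nullary using (¬_)

open import Defs

open CommutativeRing +-*-commutativeRing using (commutativeSemiring; semiring)
open import Algebra.Properties.Semiring.Mult semiring using (_×_)
open HornerEvaluation commutativeSemiring

÷-*-cancel : ∀ p q .{{_ : NonZero q}} → p ÷ q * q ≡ p
÷-*-cancel p q = begin
  p * (1/ q) * q   ≡⟨ *-assoc p _ q ⟩
  p * (1/ q * q)   ≡⟨ cong (p *_) (*-inverseˡ q) ⟩
  p * 1ℚ           ≡⟨ *-identityʳ p ⟩
  p                ∎
  where open ≡-Reasoning

*-÷-cancel : ∀ p q .{{_ : NonZero q}} → p * q ÷ q ≡ p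
*-÷-cancel p q = begin
  p * q * (1/ q)   ≡⟨ *-assoc p q _ ⟩
  p * (q * 1/ q)   ≡⟨ cong (p *_) (*-inverseʳ q) ⟩
  p * 1ℚ           ≡⟨ *-identityʳ p ⟩
  p                ∎
  where open ≡-Reasoning

*-cancelʳ-≡ : ∀ {p q} r .{{_ : NonZero r}} → p * r ≡ q * r → p ≡ q
*-cancelʳ-≡ {p} {q} r pr≡qr = trans (sym (*-÷-cancel p r)) (trans (cong (_÷ r) pr≡qr) (*-÷-cancel q r))

÷-quartic : ∀ p p' q q' r r' .{{_ : NonZero p'}} .{{_ : NonZero q'}} .{{_ : NonZero r'}} →
            (p * q + p' * q') * r' ⁴ ≡ r ⁴ * (p' * q') → p ÷ p' * (q ÷ q') + 1ℚ ≡ (r ÷ r') ⁴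
÷-quartic p p' q q' r r' eq = cancel (begin
  (u * v + 1ℚ) * p' * q' * r' * r' * r' * r'   ≡⟨ solve 5 (λ u v p' q' r' →
                                                    (u :* v :+ con 1ℚ) :* p' :* q' :* r' :* r' :* r' :* r'
                                                    := (u :* p' :* (v :* q') :+ p' :* q') :* (r' :* r' :* r' :* r'))
                                                  refl u v p' q' r' ⟩
  (u * p' * (v * q') + p' * q') * r' ⁴         ≡⟨ cong₂ (λ a b → (a * b + p' * q') * r' ⁴) (÷-*-cancel p p') (÷-*-cancel q q') ⟩
  (p * q + p' * q') * r' ⁴                     ≡⟨ eq ⟩
  r ⁴ * (p' * q')                              ≡⟨ cong (λ a → a ⁴ * (p' * q')) (÷-*-cancel r r') ⟨
  (w * r') ⁴ * (p' * q')                       ≡⟨ solve 4 (λ w p' q' r' →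
                                                    (w :* r') :* (w :* r') :* (w :* r') :* (w :* r') :* (p' :* q')
                                                    := w :* w :* w :* w :* p' :* q' :* r' :* r' :* r' :* r')
                                                  refl w p' q' r' ⟩
  w ⁴ * p' * q' * r' * r' * r' * r'            ∎)
  where
  open ≡-Reasoning
  open +-*-Solver
  u = p ÷ p'
  v = q ÷ q'
  w = r ÷ r'
  cancel : ∀ {a b} → a * p' * q' * r' * r' * r' * r' ≡ b * p' * q' * r' * r' * r' * r' → a ≡ b
  cancel = *-cancelʳ-≡ p' ∘ *-cancelʳ-≡ q' ∘ *-cancelʳ-≡ r' ∘ *-cancelʳ-≡ r' ∘ *-cancelʳ-≡ r' ∘ *-cancelʳ-≡ r'

÷-<-÷ : ∀ p q r s .{{_ : Positive q}} .{{_ : Positive s}} → p * s < r * q →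
        (p ÷ q) {{pos⇒nonZero q}} < (r ÷ s) {{pos⇒nonZero s}}
÷-<-÷ p q r s ps<rq = *-cancelʳ-<-nonNeg (q * s) {{pos⇒nonNeg (q * s) {{pos*pos⇒pos q s}}}} (begin-strict
  p ÷ q * (q * s)   ≡⟨ *-assoc (p ÷ q) q s ⟨
  p ÷ q * q * s     ≡⟨ cong (_* s) (÷-*-cancel p q) ⟩
  p * s             <⟨ ps<rq ⟩
  r * q             ≡⟨ cong (_* q) (÷-*-cancel r s) ⟨
  r ÷ s * s * q     ≡⟨ *-assoc (r ÷ s) s q ⟩
  r ÷ s * (s * q)   ≡⟨ cong (r ÷ s *_) (*-comm s q) ⟩
  r ÷ s * (q * s)   ∎)
  where
  open ≤-Reasoning
  instance
    q≢0 : NonZero q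
    q≢0 = pos⇒nonZero q
    s≢0 : NonZero s
    s≢0 = pos⇒nonZero s

÷-positive : ∀ p q .{{_ : Positive p}} .{{_ : Positive q}} → 0ℚ < (p ÷ q) {{pos⇒nonZero q}}
÷-positive p q = positive⁻¹ _ {{pos*pos⇒pos p _ {{1/pos⇒pos q}}}}

*<⇒<÷ : ∀ p r s .{{_ : Positive s}} → p * s < r → p < (r ÷ s) {{pos⇒nonZero s}}
*<⇒<÷ p r s ps<r = *-cancelʳ-<-nonNeg s {{pos⇒nonNeg s}} (begin-strict
  p * s           <⟨ ps<r ⟩
  r               ≡⟨ ÷-*-cancel r s ⟨
  r ÷ s * s       ∎)
  where
  open ≤-Reasoning
  instance
    s≢0 : NonZero s
    s≢0 = pos⇒nonZero s

×1-nonNegative : ∀ n → NonNegative (n × 1ℚ)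
×1-nonNegative zero = _
×1-nonNegative (suc n) = nonNeg+nonNeg⇒nonNeg 1ℚ (n × 1ℚ) {{×1-nonNegative n}}

⟦⟧-nonNegative : ∀ p x .{{_ : NonNegative x}} → NonNegative (⟦ p ⟧ x)
⟦⟧-nonNegative [] x = _
⟦⟧-nonNegative (n ∷ p) x =
  nonNeg+nonNeg⇒nonNeg (n × 1ℚ) {{×1-nonNegative n}} (x * ⟦ p ⟧ x)
    {{nonNeg*nonNeg⇒nonNeg x (⟦ p ⟧ x) {{⟦⟧-nonNegative p x}}}}

⟦⟧-positive : ∀ p .{{_ : PositiveConstant p}} x .{{_ : NonNegative x}} → Positive (⟦ p ⟧ x)
⟦⟧-positive [] {{()}} x
⟦⟧-positive (zero ∷ p) {{()}} x
⟦⟧-positive (suc n ∷ p) x =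
  pos+nonNeg⇒pos (1ℚ + n × 1ℚ) {{pos+nonNeg⇒pos 1ℚ (n × 1ℚ) {{×1-nonNegative n}}}} (x * ⟦ p ⟧ x)
    {{nonNeg*nonNeg⇒nonNeg x (⟦ p ⟧ x) {{⟦⟧-nonNegative p x}}}}

≺⇒⟦⟧< : ∀ {p q} → p ≺ q → ∀ x .{{_ : NonNegative x}} → ⟦ p ⟧ x < ⟦ q ⟧ x
≺⇒⟦⟧< {p} {q} (≺-gap p⊕gap≡q) x = begin-strict
  ⟦ p ⟧ x                  ≡⟨ +-identityʳ _ ⟨
  ⟦ p ⟧ x + 0ℚ             <⟨ +-monoʳ-< (⟦ p ⟧ x) (positive⁻¹ _ {{⟦⟧-positive (q ⊖ p) x}}) ⟩
  ⟦ p ⟧ x + ⟦ q ⊖ p ⟧ x    ≡⟨ ⟦⊕⟧ p (q ⊖ p) x ⟨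
  ⟦ p ⊕ (q ⊖ p) ⟧ x        ≡⟨ cong (λ r → ⟦ r ⟧ x) p⊕gap≡q ⟩
  ⟦ q ⟧ x                  ∎
  where open ≤-Reasoning

-- Opaque so that the type checker never unfolds an evaluation at the concrete
-- polynomials below, whose numerals are embedded in unary as n × 1ℚ.
opaque
  ⟦_/_⟧ : (p q : Poly) .{{_ : PositiveConstant q}} (x : ℚ) .{{_ : NonNegative x}} → ℚ
  ⟦ p / q ⟧ x = (⟦ p ⟧ x ÷ ⟦ q ⟧ x) {{pos⇒nonZero (⟦ q ⟧ x) {{⟦⟧-positive q x}}}}

module _ (x : ℚ) .{{_ : NonNegative x}} where

  opaque
    unfolding ⟦_/_⟧
    ⟦/⟧-positive : ∀ p q .{{_ : PositiveConstant p}} .{{_ : PositiveConstant q}} → 0ℚ < ⟦ p / q ⟧ x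
    ⟦/⟧-positive p q = ÷-positive (⟦ p ⟧ x) (⟦ q ⟧ x) {{⟦⟧-positive p x}} {{⟦⟧-positive q x}}

    ⟦/⟧-< : ∀ p q r s .{{_ : PositiveConstant q}} .{{_ : PositiveConstant s}} →
            p ⊗ s ≺ r ⊗ q → ⟦ p / q ⟧ x < ⟦ r / s ⟧ x
    ⟦/⟧-< p q r s ps≺rq =
      ÷-<-÷ (⟦ p ⟧ x) (⟦ q ⟧ x) (⟦ r ⟧ x) (⟦ s ⟧ x) {{⟦⟧-positive q x}} {{⟦⟧-positive s x}} (begin-strict
        ⟦ p ⟧ x * ⟦ s ⟧ x   ≡⟨ ⟦⊗⟧ p s x ⟨
        ⟦ p ⊗ s ⟧ x         <⟨ ≺⇒⟦⟧< ps≺rq x ⟩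
        ⟦ r ⊗ q ⟧ x         ≡⟨ ⟦⊗⟧ r q x ⟩
        ⟦ r ⟧ x * ⟦ q ⟧ x   ∎)
      where open ≤-Reasoning

    <-⟦/⟧ : ∀ p q .{{_ : PositiveConstant q}} → X ⊗ q ≺ p → x < ⟦ p / q ⟧ x
    <-⟦/⟧ p q xq≺p = *<⇒<÷ x (⟦ p ⟧ x) (⟦ q ⟧ x) {{⟦⟧-positive q x}} (begin-strict
      x * ⟦ q ⟧ x         ≡⟨ cong (_* ⟦ q ⟧ x) (⟦X⟧ x) ⟨
      ⟦ X ⟧ x * ⟦ q ⟧ x   ≡⟨ ⟦⊗⟧ X q x ⟨
      ⟦ X ⊗ q ⟧ x         <⟨ ≺⇒⟦⟧< xq≺p x ⟩
      ⟦ p ⟧ x             ∎)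
      where open ≤-Reasoning

    ⟦/⟧-quartic : ∀ p p' q q' r r'
                  .{{_ : PositiveConstant p'}} .{{_ : PositiveConstant q'}} .{{_ : PositiveConstant r'}} →
                  (p ⊗ q ⊕ p' ⊗ q') ⊗ r' ⁴ₚ ≡ r ⁴ₚ ⊗ (p' ⊗ q') →
                  ⟦ p / p' ⟧ x * ⟦ q / q' ⟧ x + 1ℚ ≡ ⟦ r / r' ⟧ x ⁴
    ⟦/⟧-quartic p p' q q' r r' eq =
      ÷-quartic (⟦ p ⟧ x) (⟦ p' ⟧ x) (⟦ q ⟧ x) (⟦ q' ⟧ x) (⟦ r ⟧ x) (⟦ r' ⟧ x)
                {{nonZero p'}} {{nonZero q'}} {{nonZero r'}} (begin
        (⟦ p ⟧ x * ⟦ q ⟧ x + ⟦ p' ⟧ x * ⟦ q' ⟧ x) * ⟦ r' ⟧ x ⁴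
          ≡⟨ cong₂ (λ a b → (a + b) * ⟦ r' ⟧ x ⁴) (⟦⊗⟧ p q x) (⟦⊗⟧ p' q' x) ⟨
        (⟦ p ⊗ q ⟧ x + ⟦ p' ⊗ q' ⟧ x) * ⟦ r' ⟧ x ⁴
          ≡⟨ cong₂ _*_ (⟦⊕⟧ (p ⊗ q) (p' ⊗ q') x) (⟦⁴ₚ⟧ r' x) ⟨
        ⟦ p ⊗ q ⊕ p' ⊗ q' ⟧ x * ⟦ r' ⁴ₚ ⟧ x
          ≡⟨ ⟦⊗⟧ (p ⊗ q ⊕ p' ⊗ q') (r' ⁴ₚ) x ⟨
        ⟦ (p ⊗ q ⊕ p' ⊗ q') ⊗ r' ⁴ₚ ⟧ x
          ≡⟨ cong (λ f → ⟦ f ⟧ x) eq ⟩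
        ⟦ r ⁴ₚ ⊗ (p' ⊗ q') ⟧ x
          ≡⟨ ⟦⊗⟧ (r ⁴ₚ) (p' ⊗ q') x ⟩
        ⟦ r ⁴ₚ ⟧ x * ⟦ p' ⊗ q' ⟧ x
          ≡⟨ cong₂ _*_ (⟦⁴ₚ⟧ r x) (⟦⊗⟧ p' q' x) ⟩
        ⟦ r ⟧ x ⁴ * (⟦ p' ⟧ x * ⟦ q' ⟧ x)
          ∎)
      where
      open ≡-Reasoning
      nonZero : ∀ d .{{_ : PositiveConstant d}} → NonZero (⟦ d ⟧ x)
      nonZero d = pos⇒nonZero (⟦ d ⟧ x) {{⟦⟧-positive d x}}

descending⇒PositiveQDT : ∀ {a b c} → 0ℚ < c → c < b → b < a →
                         ∃ (λ r → a * b + 1ℚ ≡ r ⁴) → ∃ (λ s → a * c + 1ℚ ≡ s ⁴) → ∃ (λ t → b * c + 1ℚ ≡ t ⁴) →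
                         PositiveQDT (a , b , c)
descending⇒PositiveQDT 0<c c<b b<a r s t =
  ( >⇒≢ b<a , >⇒≢ c<a , >⇒≢ c<b , >⇒≢ 0<a , >⇒≢ 0<b , >⇒≢ 0<c , r , s , t)
  , 0<a , 0<b , 0<c
  where
  >⇒≢ : ∀ {p q} → p < q → q ≢ p
  >⇒≢ p<q = <⇒≢ p<q ∘ sym
  c<a = <-trans c<b b<a
  0<b = <-trans 0<c c<b
  0<a = <-trans 0<b b<a

maxCoordinate : List Triple → ℚ
maxCoordinate [] = 0ℚ
maxCoordinate ((a , b , c) ∷ L) = a ⊔ (b ⊔ (c ⊔ maxCoordinate L))

∈₃⇒≤maxCoordinate : ∀ {x} T L → x ∈₃ T → x ≤ maxCoordinate (T ∷ L)
∈₃⇒≤maxCoordinate (a , b , c) L (inj₁ refl) = p≤p⊔q a _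
∈₃⇒≤maxCoordinate (a , b , c) L (inj₂ (inj₁ refl)) = ≤-trans (p≤p⊔q b _) (p≤q⊔p a _)
∈₃⇒≤maxCoordinate (a , b , c) L (inj₂ (inj₂ refl)) = ≤-trans (p≤p⊔q c _) (≤-trans (p≤q⊔p b _) (p≤q⊔p a _))

maxCoordinate-tail : ∀ T L → maxCoordinate L ≤ maxCoordinate (T ∷ L)
maxCoordinate-tail (a , b , c) L = ≤-trans (p≤q⊔p c _) (≤-trans (p≤q⊔p b _) (p≤q⊔p a _))

maxCoordinate<⇒fresh : ∀ {a b c} L → maxCoordinate L < a → All (λ T → ¬ SameSet₃ (a , b , c) T) L
maxCoordinate<⇒fresh [] _ = []
maxCoordinate<⇒fresh (T ∷ L) max<a =
  (λ ((a∈T , _) , _) → <-irrefl refl (≤-<-trans (∈₃⇒≤maxCoordinate T L a∈T) max<a))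
  ∷ maxCoordinate<⇒fresh L (≤-<-trans (maxCoordinate-tail T L) max<a)

a-num a-den b-num b-den c-num c-den r-num r-den s-num s-den t-num t-den : Poly
a-num = 6304563200 ∷ 7008419840 ∷ 3510812672 ∷ 1043976192 ∷ 204131456 ∷ 27432320 ∷ 2566592 ∷ 165120 ∷ 6992 ∷ 176 ∷ 2 ∷ []
a-den = 115261696 ∷ 124365824 ∷ 57853568 ∷ 15174400 ∷ 2457904 ∷ 252096 ∷ 16008 ∷ 576 ∷ 9 ∷ []
b-num = 1587520 ∷ 1517472 ∷ 609872 ∷ 133800 ∷ 17340 ∷ 1330 ∷ 56 ∷ 1 ∷ []
b-den = 952576 ∷ 540704 ∷ 122784 ∷ 13944 ∷ 792 ∷ 18 ∷ []
c-num = 8573184 ∷ 4747264 ∷ 1052352 ∷ 116736 ∷ 6480 ∷ 144 ∷ []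
c-den = 9912320 ∷ 11016192 ∷ 5286656 ∷ 1432096 ∷ 239728 ∷ 25416 ∷ 1668 ∷ 62 ∷ 1 ∷ []
r-num = 756 ∷ 246 ∷ 27 ∷ 1 ∷ []
r-den = 244 ∷ 54 ∷ 3 ∷ []
s-num = 116 ∷ 22 ∷ 1 ∷ []
s-den = 44 ∷ 14 ∷ 1 ∷ []
t-num = 10 ∷ 1 ∷ []
t-den = 8 ∷ 1 ∷ []

ab+1≡r⁴ : (a-num ⊗ b-num ⊕ a-den ⊗ b-den) ⊗ r-den ⁴ₚ ≡ r-num ⁴ₚ ⊗ (a-den ⊗ b-den)
ab+1≡r⁴ = refl

ac+1≡s⁴ : (a-num ⊗ c-num ⊕ a-den ⊗ c-den) ⊗ s-den ⁴ₚ ≡ s-num ⁴ₚ ⊗ (a-den ⊗ c-den)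
ac+1≡s⁴ = refl

bc+1≡t⁴ : (b-num ⊗ c-num ⊕ b-den ⊗ c-den) ⊗ t-den ⁴ₚ ≡ t-num ⁴ₚ ⊗ (b-den ⊗ c-den)
bc+1≡t⁴ = refl

c≺b : c-num ⊗ b-den ≺ b-num ⊗ c-den
c≺b = ≺-gap refl

b≺a : b-num ⊗ a-den ≺ a-num ⊗ b-den
b≺a = ≺-gap refl

x≺a : X ⊗ a-den ≺ a-num
x≺a = ≺-gap refl

module QuarticFamily (x : ℚ) .{{_ : NonNegative x}} where

  a b c : ℚ
  a = ⟦ a-num / a-den ⟧ x
  b = ⟦ b-num / b-den ⟧ x
  c = ⟦ c-num / c-den ⟧ x

  x<a : x < a
  x<a = <-⟦/⟧ x a-num a-den x≺a

  isPositiveQDT : PositiveQDT (a , b , c)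
  isPositiveQDT = descending⇒PositiveQDT
    (⟦/⟧-positive x c-num c-den)
    (⟦/⟧-< x c-num c-den b-num b-den c≺b)
    (⟦/⟧-< x b-num b-den a-num a-den b≺a)
    (⟦ r-num / r-den ⟧ x , ⟦/⟧-quartic x a-num a-den b-num b-den r-num r-den ab+1≡r⁴)
    (⟦ s-num / s-den ⟧ x , ⟦/⟧-quartic x a-num a-den c-num c-den s-num s-den ac+1≡s⁴)
    (⟦ t-num / t-den ⟧ x , ⟦/⟧-quartic x b-num b-den c-num c-den t-num t-den bc+1≡t⁴)

mainTheorem1 : InfinitelyManyPositiveQDT
mainTheorem1 L = (a , b , c) , isPositiveQDT , maxCoordinate<⇒fresh L (≤-<-trans (p≤p⊔q _ 0ℚ) x<a)
  where
  instance
    x≥0 : NonNegative (maxCoordinate L ⊔ 0ℚ)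
    x≥0 = nonNegative (p≤q⊔p (maxCoordinate L) 0ℚ)
  open QuarticFamily (maxCoordinate L ⊔ 0ℚ)
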